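{- (Support extension, right.) In $LG^\omega$, let $\Pi$ be a proof of $\Sigma,h;\Gamma\vdash B[h\,\vec a/x]$, where $\{\vec a\}=supp(B)$, $h\notin\Sigma$, and $h$ is not free in $\Gamma$ and $B$. Let $\vec c$ be a list of nominal constants not in the support of $B$. Then there exists a proof $\Pi'$ of $\Sigma,h';\Gamma\vdash B[h'\,\vec a\,\vec c/x]$, where $h'\notin\Sigma$ (and $h'$ is a variable of the type of $x$ raised over the types of $\vec a$ and $\vec c$).
   Context: Logic $LG^\omega$. Terms: Church's simply typed $\lambda$-calculus; formulas have type $o$; quantifier types do not contain $o$. There are distinguished nominal types, each with infinitely many nominal constants, plus a set $\mathcal K$ of other constants. A permutation $\pi$ is a finite type-preserving bijection on nominal constants, acting on terms by $\pi.t$. $supp(t)$ = set of nominal constants in $t$. $\Sigma$-substitutions map variables to terms with no nominal constants. A variable $h$ applied to a list of nominal constants $c_1{:}\iota_1,\dots,c_n{:}\iota_n$ in place of a variable $x:\tau$ has type $\iota_1\to\dots\to\iota_n\to\tau$ ("raising"). Sequents: $\Sigma;\Gamma\vdash C$, $\Gamma$ a multiset, free variables among $\Sigma$. Rules: $id_\pi$ ($\Sigma;\Gamma,B\vdash B'$ if $\pi.B=\pi'.B'$ for some permutations); multicut $mc$ (from $\Sigma;\Delta_i\vdash B_i$, $i=1..n$, and $\Sigma;B_1..B_n,\Gamma\vdash C$ infer $\Sigma;\Delta_1..\Delta_n,\Gamma\vdash C$); contraction; $\bot L$, $\top R$; usual $\land,\lor,\supset$ rules; $\forall L$, $\exists R$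 instantiate with any well-typed term over $\Sigma$, $\mathcal K$ and nominal constants; $\forall R$ (resp. $\exists L$): from $\Sigma,h;\Gamma\vdash B[h\,\vec c/x]$ infer $\Sigma;\Gamma\vdash\forall x.B$ (dually on the left for $\exists$), $h\notin\Sigma$, $\vec c$ listing $supp(B)$, $h$ raised over $\vec c$; $\nabla L,\nabla R$: replace the $\nabla$-bound variable (of nominal type) by a nominal constant $a\notin supp(B)$; $eqR$: $\Sigma;\Gamma\vdash t=t$; $eqL$: from premises $\Sigma\theta;\Gamma\theta\vdash C\theta$ for every $\Sigma$-substitution $\theta$ with $(\lambda\vec c.s)\theta=_{\beta\eta}(\lambda\vec c.t)\theta$, $\vec c$ listing $supp(s=t)$, infer $\Sigma;\Gamma,s=t\vdash C$; $defL/defR$: unfold an atom $p\,\vec t$ to $B[\vec t/\vec x]$ for a stratified definition clause $\forall\vec x.p\,\vec x\stackrel{\triangle}{=}B$ (body level $\le$ level of $p$, implication raising the level of its antecedent by one, body free of nominal constants); $natR$: $\vdash nat\,z$, and from $\Gamma\vdash nat\,I$ infer $\Gamma\vdash nat\,(s\,I)$; $natL$: from $\vdash D\,z$, $j;D\,j\vdash D\,(s\,j)$ and $\Sigma;\Gamma,D\,I\vdash C$ infer $\Sigma;\Gamma,nat\,I\vdash C$. -}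

module Defs where

open import Data.Nat using (ℕ; zero; suc; _≤_; _⊔_; _≟_)
open import Data.Bool using (Bool; true; false; if_then_else_; _∧_)
open import Data.Product using (_×_; _,_; proj₁; proj₂)
open import Data.List using (List; []; _∷_; _++_; map; concat)
open import Data.List.Relation.Unary.All using (All; []; _∷_)
open import Data.List.Membership.Propositional using (_∈_; _∉_)
open import Data.List.Relation.Unary.Unique.Propositional using (Unique)
open import Data.List.Relation.Binary.Permutation.Propositional using (_↭_)
open import Relation.Nullary.Decidable using (⌊_⌋; yes; no)
open import Relation.Binary.PropositionalEquality using (_≡_; refl)

-- Types (the type o of formulas is not a term type: formulas are a
-- separate syntactic category, so quantifier types never contain o).

data Ty : Set where
  nom : ℕ → Ty
  bas : ℕ → Ty
  nt  : Ty
  _⇒_ : Ty → Ty → Ty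

infixr 7 _⇒_

Ctx : Set
Ctx = List Ty

data _∋_ : Ctx → Ty → Set where
  here  : ∀ {Γ τ} → (τ ∷ Γ) ∋ τ
  there : ∀ {Γ σ τ} → Γ ∋ τ → (σ ∷ Γ) ∋ τ

-- nominal constants: the k-th nominal constant of nominal type nom i
NomC : Set
NomC = ℕ × ℕ

raise : List NomC → Ty → Ty
raise []            τ = τ
raise ((i , _) ∷ cs) τ = nom i ⇒ raise cs τ

Lists : List NomC → List NomC → Set
Lists cs xs = Unique cs × ((c : NomC) → c ∈ cs → c ∈ xs) × ((c : NomC) → c ∈ xs → c ∈ cs)

-- finite permutations, as composites of type-preserving transpositions
-- (j , a , b) swaps nominal constants (j,a) and (j,b)
Perm : Set
Perm = List (ℕ × ℕ × ℕ)

swap1 : ℕ × ℕ × ℕ → ℕ → ℕ → ℕ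
swap1 (j , a , b) i k =
  if ⌊ i ≟ j ⌋ ∧ ⌊ k ≟ a ⌋ then b
  else (if ⌊ i ≟ j ⌋ ∧ ⌊ k ≟ b ⌋ then a else k)

permN : Perm → ℕ → ℕ → ℕ
permN []      i k = k
permN (s ∷ π) i k = swap1 s i (permN π i k)

module Syntax (Con : Ty → Set) (Pred : List Ty → Set) where

  data Tm (Γ : Ctx) : Ty → Set where
    var   : ∀ {τ} → Γ ∋ τ → Tm Γ τ
    con   : ∀ {τ} → Con τ → Tm Γ τ
    nm    : (i k : ℕ) → Tm Γ (nom i)
    zeroT : Tm Γ nt
    succT : Tm Γ nt → Tm Γ nt
    lam   : ∀ {σ τ} → Tm (σ ∷ Γ) τ → Tm Γ (σ ⇒ τ)
    app   : ∀ {σ τ} → Tm Γ (σ ⇒ τ) → Tm Γ σ → Tm Γ τ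

  Ren : Ctx → Ctx → Set
  Ren Γ Δ = ∀ {τ} → Γ ∋ τ → Δ ∋ τ

  ext : ∀ {Γ Δ σ} → Ren Γ Δ → Ren (σ ∷ Γ) (σ ∷ Δ)
  ext ρ here      = here
  ext ρ (there x) = there (ρ x)

  ren : ∀ {Γ Δ τ} → Ren Γ Δ → Tm Γ τ → Tm Δ τ
  ren ρ (var x)   = var (ρ x)
  ren ρ (con c)   = con c
  ren ρ (nm i k)  = nm i k
  ren ρ zeroT     = zeroT
  ren ρ (succT t) = succT (ren ρ t)
  ren ρ (lam t)   = lam (ren (ext ρ) t)
  ren ρ (app t u) = app (ren ρ t) (ren ρ u)

  wk : ∀ {Γ σ τ} → Tm Γ τ → Tm (σ ∷ Γ) τ
  wk = ren there

  Sub : Ctx → Ctx → Set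
  Sub Γ Δ = ∀ {τ} → Γ ∋ τ → Tm Δ τ

  exts : ∀ {Γ Δ σ} → Sub Γ Δ → Sub (σ ∷ Γ) (σ ∷ Δ)
  exts θ here      = var here
  exts θ (there x) = wk (θ x)

  sub : ∀ {Γ Δ τ} → Sub Γ Δ → Tm Γ τ → Tm Δ τ
  sub θ (var x)   = θ x
  sub θ (con c)   = con c
  sub θ (nm i k)  = nm i k
  sub θ zeroT     = zeroT
  sub θ (succT t) = succT (sub θ t)
  sub θ (lam t)   = lam (sub (exts θ) t)
  sub θ (app t u) = app (sub θ t) (sub θ u)

  sub0 : ∀ {Γ σ} → Tm Γ σ → Sub (σ ∷ Γ) Γ
  sub0 u here      = u
  sub0 u (there x) = var x

  infix 4 _≈_
  data _≈_ : ∀ {Γ τ} → Tm Γ τ → Tm Γ τ → Set where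
    β     : ∀ {Γ σ τ} (t : Tm (σ ∷ Γ) τ) (u : Tm Γ σ) → app (lam t) u ≈ sub (sub0 u) t
    η     : ∀ {Γ σ τ} (t : Tm Γ (σ ⇒ τ)) → lam (app (wk t) (var here)) ≈ t
    ≈refl : ∀ {Γ τ} {t : Tm Γ τ} → t ≈ t
    ≈sym  : ∀ {Γ τ} {t u : Tm Γ τ} → t ≈ u → u ≈ t
    ≈trans : ∀ {Γ τ} {t u v : Tm Γ τ} → t ≈ u → u ≈ v → t ≈ v
    succ≈ : ∀ {Γ} {t u : Tm Γ nt} → t ≈ u → succT t ≈ succT u
    lam≈  : ∀ {Γ σ τ} {t u : Tm (σ ∷ Γ) τ} → t ≈ u → lam t ≈ lam u
    app≈  : ∀ {Γ σ τ} {t t' : Tm Γ (σ ⇒ τ)} {u u' : Tm Γ σ} →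
            t ≈ t' → u ≈ u' → app t u ≈ app t' u'

  suppT : ∀ {Γ τ} → Tm Γ τ → List NomC
  suppT (var x)   = []
  suppT (con c)   = []
  suppT (nm i k)  = (i , k) ∷ []
  suppT zeroT     = []
  suppT (succT t) = suppT t
  suppT (lam t)   = suppT t
  suppT (app t u) = suppT t ++ suppT u

  permT : ∀ {Γ τ} → Perm → Tm Γ τ → Tm Γ τ
  permT π (var x)   = var x
  permT π (con c)   = con c
  permT π (nm i k)  = nm i (permN π i k)
  permT π zeroT     = zeroT
  permT π (succT t) = succT (permT π t)
  permT π (lam t)   = lam (permT π t)
  permT π (app t u) = app (permT π t) (permT π u)

  absNomG : ∀ {Γ Δ τ} (i k : ℕ) → Ren Γ Δ → Δ ∋ nom i → Tm Γ τ → Tm Δ τ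
  absNomG i k ρ v (var x)   = var (ρ x)
  absNomG i k ρ v (con c)   = con c
  absNomG i k ρ v (nm i' k') with i ≟ i' | k ≟ k'
  ... | yes refl | yes refl = var v
  ... | _        | _        = nm i' k'
  absNomG i k ρ v zeroT     = zeroT
  absNomG i k ρ v (succT t) = succT (absNomG i k ρ v t)
  absNomG i k ρ v (lam t)   = lam (absNomG i k (ext ρ) (there v) t)
  absNomG i k ρ v (app t u) = app (absNomG i k ρ v t) (absNomG i k ρ v u)

  absList : ∀ {Γ τ} (cs : List NomC) → Tm Γ τ → Tm Γ (raise cs τ)
  absList []            t = t
  absList ((i , k) ∷ cs) t = lam (absNomG i k there here (absList cs t))

  applyNoms : ∀ {Γ τ} (cs : List NomC) → Tm Γ (raise cs τ) → Tm Γ τ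
  applyNoms []            t = t
  applyNoms ((i , k) ∷ cs) t = applyNoms cs (app t (nm i k))

  -- [h c1 ... cn / x], where h is the new innermost variable replacing x
  raiseSub : ∀ {Ξ τ} (cs : List NomC) → Sub (τ ∷ Ξ) (raise cs τ ∷ Ξ)
  raiseSub cs here      = applyNoms cs (var here)
  raiseSub cs (there x) = var (there x)

  infixr 6 _∧F_
  infixr 5 _∨F_
  infixr 4 _⊃F_

  data Fm (Γ : Ctx) : Set where
    ⊤F ⊥F : Fm Γ
    _∧F_ _∨F_ _⊃F_ : Fm Γ → Fm Γ → Fm Γ
    ∀F ∃F : (τ : Ty) → Fm (τ ∷ Γ) → Fm Γ
    ∇F   : (i : ℕ) → Fm (nom i ∷ Γ) → Fm Γ
    eqF  : (τ : Ty) → Tm Γ τ → Tm Γ τ → Fm Γ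
    natF : Tm Γ nt → Fm Γ
    defF : ∀ {tys} → Pred tys → All (Tm Γ) tys → Fm Γ

  renArgs : ∀ {Γ Δ tys} → Ren Γ Δ → All (Tm Γ) tys → All (Tm Δ) tys
  renArgs ρ []       = []
  renArgs ρ (t ∷ ts) = ren ρ t ∷ renArgs ρ ts

  renF : ∀ {Γ Δ} → Ren Γ Δ → Fm Γ → Fm Δ
  renF ρ ⊤F         = ⊤F
  renF ρ ⊥F         = ⊥F
  renF ρ (A ∧F B)   = renF ρ A ∧F renF ρ B
  renF ρ (A ∨F B)   = renF ρ A ∨F renF ρ B
  renF ρ (A ⊃F B)   = renF ρ A ⊃F renF ρ B
  renF ρ (∀F τ B)   = ∀F τ (renF (ext ρ) B)
  renF ρ (∃F τ B)   = ∃F τ (renF (ext ρ) B)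
  renF ρ (∇F i B)   = ∇F i (renF (ext ρ) B)
  renF ρ (eqF τ s t) = eqF τ (ren ρ s) (ren ρ t)
  renF ρ (natF t)   = natF (ren ρ t)
  renF ρ (defF p ts) = defF p (renArgs ρ ts)

  wkF : ∀ {Γ σ} → Fm Γ → Fm (σ ∷ Γ)
  wkF = renF there

  subArgs : ∀ {Γ Δ tys} → Sub Γ Δ → All (Tm Γ) tys → All (Tm Δ) tys
  subArgs θ []       = []
  subArgs θ (t ∷ ts) = sub θ t ∷ subArgs θ ts

  subF : ∀ {Γ Δ} → Sub Γ Δ → Fm Γ → Fm Δ
  subF θ ⊤F         = ⊤F
  subF θ ⊥F         = ⊥F
  subF θ (A ∧F B)   = subF θ A ∧F subF θ B
  subF θ (A ∨F B)   = subF θ A ∨F subF θ B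
  subF θ (A ⊃F B)   = subF θ A ⊃F subF θ B
  subF θ (∀F τ B)   = ∀F τ (subF (exts θ) B)
  subF θ (∃F τ B)   = ∃F τ (subF (exts θ) B)
  subF θ (∇F i B)   = ∇F i (subF (exts θ) B)
  subF θ (eqF τ s t) = eqF τ (sub θ s) (sub θ t)
  subF θ (natF t)   = natF (sub θ t)
  subF θ (defF p ts) = defF p (subArgs θ ts)

  suppArgs : ∀ {Γ tys} → All (Tm Γ) tys → List NomC
  suppArgs []       = []
  suppArgs (t ∷ ts) = suppT t ++ suppArgs ts

  suppF : ∀ {Γ} → Fm Γ → List NomC
  suppF ⊤F          = []
  suppF ⊥F          = []
  suppF (A ∧F B)    = suppF A ++ suppF B
  suppF (A ∨F B)    = suppF A ++ suppF B
  suppF (A ⊃F B)    = suppF A ++ suppF B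
  suppF (∀F τ B)    = suppF B
  suppF (∃F τ B)    = suppF B
  suppF (∇F i B)    = suppF B
  suppF (eqF τ s t) = suppT s ++ suppT t
  suppF (natF t)    = suppT t
  suppF (defF p ts) = suppArgs ts

  permArgs : ∀ {Γ tys} → Perm → All (Tm Γ) tys → All (Tm Γ) tys
  permArgs π []       = []
  permArgs π (t ∷ ts) = permT π t ∷ permArgs π ts

  permF : ∀ {Γ} → Perm → Fm Γ → Fm Γ
  permF π ⊤F          = ⊤F
  permF π ⊥F          = ⊥F
  permF π (A ∧F B)    = permF π A ∧F permF π B
  permF π (A ∨F B)    = permF π A ∨F permF π B
  permF π (A ⊃F B)    = permF π A ⊃F permF π B
  permF π (∀F τ B)    = ∀F τ (permF π B)
  permF π (∃F τ B)    = ∃F τ (permF π B)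
  permF π (∇F i B)    = ∇F i (permF π B)
  permF π (eqF τ s t) = eqF τ (permT π s) (permT π t)
  permF π (natF t)    = natF (permT π t)
  permF π (defF p ts) = defF p (permArgs π ts)

  data _≈A_ {Γ : Ctx} : ∀ {tys} → All (Tm Γ) tys → All (Tm Γ) tys → Set where
    []  : [] ≈A []
    _∷_ : ∀ {τ tys} {t u : Tm Γ τ} {ts us : All (Tm Γ) tys} →
          t ≈ u → ts ≈A us → (t ∷ ts) ≈A (u ∷ us)

  data _≈F_ : ∀ {Γ} → Fm Γ → Fm Γ → Set where
    ⊤≈ : ∀ {Γ} → _≈F_ {Γ} ⊤F ⊤F
    ⊥≈ : ∀ {Γ} → _≈F_ {Γ} ⊥F ⊥F
    ∧≈ : ∀ {Γ} {A A' B B' : Fm Γ} → A ≈F A' → B ≈F B' → (A ∧F B) ≈F (A' ∧F B')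
    ∨≈ : ∀ {Γ} {A A' B B' : Fm Γ} → A ≈F A' → B ≈F B' → (A ∨F B) ≈F (A' ∨F B')
    ⊃≈ : ∀ {Γ} {A A' B B' : Fm Γ} → A ≈F A' → B ≈F B' → (A ⊃F B) ≈F (A' ⊃F B')
    ∀≈ : ∀ {Γ τ} {B B' : Fm (τ ∷ Γ)} → B ≈F B' → ∀F τ B ≈F ∀F τ B'
    ∃≈ : ∀ {Γ τ} {B B' : Fm (τ ∷ Γ)} → B ≈F B' → ∃F τ B ≈F ∃F τ B'
    ∇≈ : ∀ {Γ i} {B B' : Fm (nom i ∷ Γ)} → B ≈F B' → ∇F i B ≈F ∇F i B'
    eq≈ : ∀ {Γ τ} {s s' t t' : Tm Γ τ} → s ≈ s' → t ≈ t' → eqF τ s t ≈F eqF τ s' t'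
    nat≈ : ∀ {Γ} {t t' : Tm Γ nt} → t ≈ t' → natF t ≈F natF t'
    def≈ : ∀ {Γ tys} {p : Pred tys} {ts us : All (Tm Γ) tys} → ts ≈A us → defF p ts ≈F defF p us

  levelF : (∀ {tys} → Pred tys → ℕ) → ∀ {Γ} → Fm Γ → ℕ
  levelF lv ⊤F          = 0
  levelF lv ⊥F          = 0
  levelF lv (A ∧F B)    = levelF lv A ⊔ levelF lv B
  levelF lv (A ∨F B)    = levelF lv A ⊔ levelF lv B
  levelF lv (A ⊃F B)    = suc (levelF lv A) ⊔ levelF lv B
  levelF lv (∀F τ B)    = levelF lv B
  levelF lv (∃F τ B)    = levelF lv B
  levelF lv (∇F i B)    = levelF lv B
  levelF lv (eqF τ s t) = 0
  levelF lv (natF t)    = 0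
  levelF lv (defF p ts) = lv p

  argSub : ∀ {Γ tys} → All (Tm Γ) tys → Sub tys Γ
  argSub (t ∷ ts) here      = t
  argSub (t ∷ ts) (there x) = argSub ts x

-- A signature: constants K, defined predicates, and a stratified set of
-- definition clauses  ∀ x1..xn. p x1..xn ≜ body p  (body over x1..xn,
-- x1 being the innermost de Bruijn variable `here`).

record Sig : Set₁ where
  field
    Con   : Ty → Set
    Pred  : List Ty → Set
    body  : ∀ {tys} → Pred tys → Syntax.Fm Con Pred tys
    lvl   : ∀ {tys} → Pred tys → ℕ
    body-nominal-free : ∀ {tys} (p : Pred tys) → Syntax.suppF Con Pred (body p) ≡ []
    stratified : ∀ {tys} (p : Pred tys) → Syntax.levelF Con Pred lvl (body p) ≤ lvl p

module LG (S : Sig) where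
  open Sig S public
  open Syntax Con Pred public

  unfold : ∀ {Γ tys} → Pred tys → All (Tm Γ) tys → Fm Γ
  unfold p ts = subF (argSub ts) (body p)

  NomFree : ∀ {Ξ Ξ'} → Sub Ξ Ξ' → Set
  NomFree {Ξ} θ = ∀ {τ} (x : Ξ ∋ τ) → suppT (θ x) ≡ []

  single : ∀ {Ξ σ} → Tm Ξ σ → Sub (σ ∷ []) Ξ
  single t here = t

  succSub : Sub (nt ∷ []) (nt ∷ [])
  succSub here = succT (var here)

  infix 3 _⨾_⊢_
  -- Ξ ; Γ ⊢ C  with Γ a multiset (lists up to permutation, rule exch)
  data _⨾_⊢_ : (Ξ : Ctx) → List (Fm Ξ) → Fm Ξ → Set where
    exch  : ∀ {Ξ Γ Γ' C} → Γ ↭ Γ' → Ξ ⨾ Γ ⊢ C → Ξ ⨾ Γ' ⊢ C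
    idπ   : ∀ {Ξ Γ B B'} (π π' : Perm) → permF π B ≈F permF π' B' → Ξ ⨾ B ∷ Γ ⊢ B'
    mc    : ∀ {Ξ Γ C} (ps : List (List (Fm Ξ) × Fm Ξ)) →
            All (λ p → Ξ ⨾ proj₁ p ⊢ proj₂ p) ps →
            Ξ ⨾ map proj₂ ps ++ Γ ⊢ C →
            Ξ ⨾ concat (map proj₁ ps) ++ Γ ⊢ C
    contr : ∀ {Ξ Γ B C} → Ξ ⨾ B ∷ B ∷ Γ ⊢ C → Ξ ⨾ B ∷ Γ ⊢ C
    ⊥L    : ∀ {Ξ Γ C} → Ξ ⨾ ⊥F ∷ Γ ⊢ C
    ⊤R    : ∀ {Ξ Γ} → Ξ ⨾ Γ ⊢ ⊤F
    ∧L₁   : ∀ {Ξ Γ B B' C} → Ξ ⨾ B ∷ Γ ⊢ C → Ξ ⨾ (B ∧F B') ∷ Γ ⊢ C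
    ∧L₂   : ∀ {Ξ Γ B B' C} → Ξ ⨾ B' ∷ Γ ⊢ C → Ξ ⨾ (B ∧F B') ∷ Γ ⊢ C
    ∧R    : ∀ {Ξ Γ B B'} → Ξ ⨾ Γ ⊢ B → Ξ ⨾ Γ ⊢ B' → Ξ ⨾ Γ ⊢ B ∧F B'
    ∨L    : ∀ {Ξ Γ B B' C} → Ξ ⨾ B ∷ Γ ⊢ C → Ξ ⨾ B' ∷ Γ ⊢ C → Ξ ⨾ (B ∨F B') ∷ Γ ⊢ C
    ∨R₁   : ∀ {Ξ Γ B B'} → Ξ ⨾ Γ ⊢ B → Ξ ⨾ Γ ⊢ B ∨F B'
    ∨R₂   : ∀ {Ξ Γ B B'} → Ξ ⨾ Γ ⊢ B' → Ξ ⨾ Γ ⊢ B ∨F B'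
    ⊃L    : ∀ {Ξ Γ B B' C} → Ξ ⨾ Γ ⊢ B → Ξ ⨾ B' ∷ Γ ⊢ C → Ξ ⨾ (B ⊃F B') ∷ Γ ⊢ C
    ⊃R    : ∀ {Ξ Γ B B'} → Ξ ⨾ B ∷ Γ ⊢ B' → Ξ ⨾ Γ ⊢ B ⊃F B'
    ∀L    : ∀ {Ξ Γ τ B C} (t : Tm Ξ τ) → Ξ ⨾ subF (sub0 t) B ∷ Γ ⊢ C → Ξ ⨾ ∀F τ B ∷ Γ ⊢ C
    ∃R    : ∀ {Ξ Γ τ B} (t : Tm Ξ τ) → Ξ ⨾ Γ ⊢ subF (sub0 t) B → Ξ ⨾ Γ ⊢ ∃F τ B
    ∀R    : ∀ {Ξ Γ τ B} (cs : List NomC) → Lists cs (suppF B) →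
            (raise cs τ ∷ Ξ) ⨾ map wkF Γ ⊢ subF (raiseSub cs) B →
            Ξ ⨾ Γ ⊢ ∀F τ B
    ∃L    : ∀ {Ξ Γ τ B C} (cs : List NomC) → Lists cs (suppF B) →
            (raise cs τ ∷ Ξ) ⨾ subF (raiseSub cs) B ∷ map wkF Γ ⊢ wkF C →
            Ξ ⨾ ∃F τ B ∷ Γ ⊢ C
    ∇L    : ∀ {Ξ Γ i B C} (k : ℕ) → (i , k) ∉ suppF B →
            Ξ ⨾ subF (sub0 (nm i k)) B ∷ Γ ⊢ C → Ξ ⨾ ∇F i B ∷ Γ ⊢ C
    ∇R    : ∀ {Ξ Γ i B} (k : ℕ) → (i , k) ∉ suppF B →
            Ξ ⨾ Γ ⊢ subF (sub0 (nm i k)) B → Ξ ⨾ Γ ⊢ ∇F i B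
    eqR   : ∀ {Ξ Γ τ} {s t : Tm Ξ τ} → s ≈ t → Ξ ⨾ Γ ⊢ eqF τ s t
    eqL   : ∀ {Ξ Γ τ C} {s t : Tm Ξ τ} (cs : List NomC) → Lists cs (suppF (eqF τ s t)) →
            ((Ξ' : Ctx) (θ : Sub Ξ Ξ') → NomFree θ →
               sub θ (absList cs s) ≈ sub θ (absList cs t) →
               Ξ' ⨾ map (subF θ) Γ ⊢ subF θ C) →
            Ξ ⨾ eqF τ s t ∷ Γ ⊢ C
    defL  : ∀ {Ξ Γ C tys} (p : Pred tys) (ts : All (Tm Ξ) tys) →
            Ξ ⨾ unfold p ts ∷ Γ ⊢ C → Ξ ⨾ defF p ts ∷ Γ ⊢ C
    defR  : ∀ {Ξ Γ tys} (p : Pred tys) (ts : All (Tm Ξ) tys) →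
            Ξ ⨾ Γ ⊢ unfold p ts → Ξ ⨾ Γ ⊢ defF p ts
    natRz : ∀ {Ξ Γ} → Ξ ⨾ Γ ⊢ natF zeroT
    natRs : ∀ {Ξ Γ I} → Ξ ⨾ Γ ⊢ natF I → Ξ ⨾ Γ ⊢ natF (succT I)
    natL  : ∀ {Ξ Γ C I} (D : Fm (nt ∷ [])) →
            [] ⨾ [] ⊢ subF (single zeroT) D →
            (nt ∷ []) ⨾ D ∷ [] ⊢ subF succSub D →
            Ξ ⨾ subF (single I) D ∷ Γ ⊢ C →
            Ξ ⨾ natF I ∷ Γ ⊢ C

-- From the premise, ∀R gives Γ ⊢ ∀x.B.  Renaming is admissible, so this
-- also holds with the fresh variable h' in context; instantiating the ∀ at
-- h' a⃗ c⃗ (∀L, closed by id) and cutting (mc) yields Γ ⊢ B[h' a⃗ c⃗ / x].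
module Submission where

open import Defs
open import Data.List using (List; []; _∷_; map; _++_; concat)
open import Data.List.Membership.Propositional using (_∈_; _∉_)
open import Data.List.Properties using (map-++; map-∘; map-cong; concat-map; ++-identityʳ)
open import Data.List.Relation.Unary.All using (All; []; _∷_)
import Data.List.Relation.Binary.Permutation.Propositional.Properties as ↭
open import Data.Nat using (ℕ; _≟_)
open import Data.Product using (_×_; _,_; proj₁; proj₂)
open import Relation.Binary.PropositionalEquality
open import Relation.Nullary.Decidable using (yes; no)

module SyntaxProperties (Con : Ty → Set) (Pred : List Ty → Set) where
  open Syntax Con Pred

  ext-ren : ∀ {Γ Δ Θ σ} {ρ : Ren Γ Δ} {ρ' : Ren Δ Θ} {ρ'' : Ren Γ Θ} →
    (∀ {τ} (x : Γ ∋ τ) → ρ' (ρ x) ≡ ρ'' x) →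
    ∀ {τ} (x : (σ ∷ Γ) ∋ τ) → ext ρ' (ext ρ x) ≡ ext ρ'' x
  ext-ren h here      = refl
  ext-ren h (there x) = cong there (h x)

  ren-ren : ∀ {Γ Δ Θ} {ρ : Ren Γ Δ} {ρ' : Ren Δ Θ} {ρ'' : Ren Γ Θ} →
    (∀ {τ} (x : Γ ∋ τ) → ρ' (ρ x) ≡ ρ'' x) →
    ∀ {τ} (t : Tm Γ τ) → ren ρ' (ren ρ t) ≡ ren ρ'' t
  ren-ren h (var x)   = cong var (h x)
  ren-ren h (con c)   = refl
  ren-ren h (nm i k)  = refl
  ren-ren h zeroT     = refl
  ren-ren h (succT t) = cong succT (ren-ren h t)
  ren-ren h (lam t)   = cong lam (ren-ren (ext-ren h) t)
  ren-ren h (app t u) = cong₂ app (ren-ren h t) (ren-ren h u)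

  ren-ext-wk : ∀ {Γ Δ σ τ} (ρ : Ren Γ Δ) (t : Tm Γ τ) →
    ren (ext {σ = σ} ρ) (wk t) ≡ wk (ren ρ t)
  ren-ext-wk ρ t = trans (ren-ren (λ _ → refl) t) (sym (ren-ren (λ _ → refl) t))

  exts-ren : ∀ {Γ Δ Θ σ} {ρ : Ren Γ Δ} {θ : Sub Δ Θ} {θ'' : Sub Γ Θ} →
    (∀ {τ} (x : Γ ∋ τ) → θ (ρ x) ≡ θ'' x) →
    ∀ {τ} (x : (σ ∷ Γ) ∋ τ) → exts θ (ext ρ x) ≡ exts θ'' x
  exts-ren h here      = refl
  exts-ren h (there x) = cong wk (h x)

  sub-ren : ∀ {Γ Δ Θ} {ρ : Ren Γ Δ} {θ : Sub Δ Θ} {θ'' : Sub Γ Θ} →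
    (∀ {τ} (x : Γ ∋ τ) → θ (ρ x) ≡ θ'' x) →
    ∀ {τ} (t : Tm Γ τ) → sub θ (ren ρ t) ≡ sub θ'' t
  sub-ren h (var x)   = h x
  sub-ren h (con c)   = refl
  sub-ren h (nm i k)  = refl
  sub-ren h zeroT     = refl
  sub-ren h (succT t) = cong succT (sub-ren h t)
  sub-ren h (lam t)   = cong lam (sub-ren (exts-ren h) t)
  sub-ren h (app t u) = cong₂ app (sub-ren h t) (sub-ren h u)

  ren-exts : ∀ {Γ Δ Θ σ} {θ : Sub Γ Δ} {ρ : Ren Δ Θ} {θ'' : Sub Γ Θ} →
    (∀ {τ} (x : Γ ∋ τ) → ren ρ (θ x) ≡ θ'' x) →
    ∀ {τ} (x : (σ ∷ Γ) ∋ τ) → ren (ext ρ) (exts θ x) ≡ exts θ'' x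
  ren-exts h here                  = refl
  ren-exts {θ = θ} {ρ} h (there x) = trans (ren-ext-wk ρ (θ x)) (cong wk (h x))

  ren-sub : ∀ {Γ Δ Θ} {θ : Sub Γ Δ} {ρ : Ren Δ Θ} {θ'' : Sub Γ Θ} →
    (∀ {τ} (x : Γ ∋ τ) → ren ρ (θ x) ≡ θ'' x) →
    ∀ {τ} (t : Tm Γ τ) → ren ρ (sub θ t) ≡ sub θ'' t
  ren-sub h (var x)   = h x
  ren-sub h (con c)   = refl
  ren-sub h (nm i k)  = refl
  ren-sub h zeroT     = refl
  ren-sub h (succT t) = cong succT (ren-sub h t)
  ren-sub h (lam t)   = cong lam (ren-sub (ren-exts h) t)
  ren-sub h (app t u) = cong₂ app (ren-sub h t) (ren-sub h u)

  ren-sub0-var : ∀ {Γ Δ σ} (ρ : Ren Γ Δ) (u : Tm Γ σ) →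
    ∀ {τ} (x : (σ ∷ Γ) ∋ τ) → ren ρ (sub0 u x) ≡ sub0 (ren ρ u) (ext ρ x)
  ren-sub0-var ρ u here      = refl
  ren-sub0-var ρ u (there x) = refl

  ren-sub0 : ∀ {Γ Δ σ τ} (ρ : Ren Γ Δ) (u : Tm Γ σ) (t : Tm (σ ∷ Γ) τ) →
    ren ρ (sub (sub0 u) t) ≡ sub (sub0 (ren ρ u)) (ren (ext ρ) t)
  ren-sub0 ρ u t = trans (ren-sub (ren-sub0-var ρ u) t) (sym (sub-ren (λ _ → refl) t))

  renArgs-renArgs : ∀ {Γ Δ Θ tys} {ρ : Ren Γ Δ} {ρ' : Ren Δ Θ} {ρ'' : Ren Γ Θ} →
    (∀ {τ} (x : Γ ∋ τ) → ρ' (ρ x) ≡ ρ'' x) →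
    (ts : All (Tm Γ) tys) → renArgs ρ' (renArgs ρ ts) ≡ renArgs ρ'' ts
  renArgs-renArgs h []       = refl
  renArgs-renArgs h (t ∷ ts) = cong₂ _∷_ (ren-ren h t) (renArgs-renArgs h ts)

  renF-renF : ∀ {Γ Δ Θ} {ρ : Ren Γ Δ} {ρ' : Ren Δ Θ} {ρ'' : Ren Γ Θ} →
    (∀ {τ} (x : Γ ∋ τ) → ρ' (ρ x) ≡ ρ'' x) →
    (A : Fm Γ) → renF ρ' (renF ρ A) ≡ renF ρ'' A
  renF-renF h ⊤F          = refl
  renF-renF h ⊥F          = refl
  renF-renF h (A ∧F B)    = cong₂ _∧F_ (renF-renF h A) (renF-renF h B)
  renF-renF h (A ∨F B)    = cong₂ _∨F_ (renF-renF h A) (renF-renF h B)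
  renF-renF h (A ⊃F B)    = cong₂ _⊃F_ (renF-renF h A) (renF-renF h B)
  renF-renF h (∀F τ B)    = cong (∀F τ) (renF-renF (ext-ren h) B)
  renF-renF h (∃F τ B)    = cong (∃F τ) (renF-renF (ext-ren h) B)
  renF-renF h (∇F i B)    = cong (∇F i) (renF-renF (ext-ren h) B)
  renF-renF h (eqF τ s t) = cong₂ (eqF τ) (ren-ren h s) (ren-ren h t)
  renF-renF h (natF t)    = cong natF (ren-ren h t)
  renF-renF h (defF p ts) = cong (defF p) (renArgs-renArgs h ts)

  subArgs-renArgs : ∀ {Γ Δ Θ tys} {ρ : Ren Γ Δ} {θ : Sub Δ Θ} {θ'' : Sub Γ Θ} →
    (∀ {τ} (x : Γ ∋ τ) → θ (ρ x) ≡ θ'' x) →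
    (ts : All (Tm Γ) tys) → subArgs θ (renArgs ρ ts) ≡ subArgs θ'' ts
  subArgs-renArgs h []       = refl
  subArgs-renArgs h (t ∷ ts) = cong₂ _∷_ (sub-ren h t) (subArgs-renArgs h ts)

  subF-renF : ∀ {Γ Δ Θ} {ρ : Ren Γ Δ} {θ : Sub Δ Θ} {θ'' : Sub Γ Θ} →
    (∀ {τ} (x : Γ ∋ τ) → θ (ρ x) ≡ θ'' x) →
    (A : Fm Γ) → subF θ (renF ρ A) ≡ subF θ'' A
  subF-renF h ⊤F          = refl
  subF-renF h ⊥F          = refl
  subF-renF h (A ∧F B)    = cong₂ _∧F_ (subF-renF h A) (subF-renF h B)
  subF-renF h (A ∨F B)    = cong₂ _∨F_ (subF-renF h A) (subF-renF h B)
  subF-renF h (A ⊃F B)    = cong₂ _⊃F_ (subF-renF h A) (subF-renF h B)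
  subF-renF h (∀F τ B)    = cong (∀F τ) (subF-renF (exts-ren h) B)
  subF-renF h (∃F τ B)    = cong (∃F τ) (subF-renF (exts-ren h) B)
  subF-renF h (∇F i B)    = cong (∇F i) (subF-renF (exts-ren h) B)
  subF-renF h (eqF τ s t) = cong₂ (eqF τ) (sub-ren h s) (sub-ren h t)
  subF-renF h (natF t)    = cong natF (sub-ren h t)
  subF-renF h (defF p ts) = cong (defF p) (subArgs-renArgs h ts)

  renArgs-subArgs : ∀ {Γ Δ Θ tys} {θ : Sub Γ Δ} {ρ : Ren Δ Θ} {θ'' : Sub Γ Θ} →
    (∀ {τ} (x : Γ ∋ τ) → ren ρ (θ x) ≡ θ'' x) →
    (ts : All (Tm Γ) tys) → renArgs ρ (subArgs θ ts) ≡ subArgs θ'' ts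
  renArgs-subArgs h []       = refl
  renArgs-subArgs h (t ∷ ts) = cong₂ _∷_ (ren-sub h t) (renArgs-subArgs h ts)

  renF-subF : ∀ {Γ Δ Θ} {θ : Sub Γ Δ} {ρ : Ren Δ Θ} {θ'' : Sub Γ Θ} →
    (∀ {τ} (x : Γ ∋ τ) → ren ρ (θ x) ≡ θ'' x) →
    (A : Fm Γ) → renF ρ (subF θ A) ≡ subF θ'' A
  renF-subF h ⊤F          = refl
  renF-subF h ⊥F          = refl
  renF-subF h (A ∧F B)    = cong₂ _∧F_ (renF-subF h A) (renF-subF h B)
  renF-subF h (A ∨F B)    = cong₂ _∨F_ (renF-subF h A) (renF-subF h B)
  renF-subF h (A ⊃F B)    = cong₂ _⊃F_ (renF-subF h A) (renF-subF h B)
  renF-subF h (∀F τ B)    = cong (∀F τ) (renF-subF (ren-exts h) B)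
  renF-subF h (∃F τ B)    = cong (∃F τ) (renF-subF (ren-exts h) B)
  renF-subF h (∇F i B)    = cong (∇F i) (renF-subF (ren-exts h) B)
  renF-subF h (eqF τ s t) = cong₂ (eqF τ) (ren-sub h s) (ren-sub h t)
  renF-subF h (natF t)    = cong natF (ren-sub h t)
  renF-subF h (defF p ts) = cong (defF p) (renArgs-subArgs h ts)

  renF-sub0 : ∀ {Γ Δ σ} (ρ : Ren Γ Δ) (u : Tm Γ σ) (A : Fm (σ ∷ Γ)) →
    renF ρ (subF (sub0 u) A) ≡ subF (sub0 (ren ρ u)) (renF (ext ρ) A)
  renF-sub0 ρ u A = trans (renF-subF (ren-sub0-var ρ u) A) (sym (subF-renF (λ _ → refl) A))

  renF-ext-wkF : ∀ {Γ Δ σ} (ρ : Ren Γ Δ) (A : Fm Γ) →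
    renF (ext {σ = σ} ρ) (wkF A) ≡ wkF (renF ρ A)
  renF-ext-wkF ρ A = trans (renF-renF (λ _ → refl) A) (sym (renF-renF (λ _ → refl) A))

  suppT-ren : ∀ {Γ Δ τ} (ρ : Ren Γ Δ) (t : Tm Γ τ) → suppT (ren ρ t) ≡ suppT t
  suppT-ren ρ (var x)   = refl
  suppT-ren ρ (con c)   = refl
  suppT-ren ρ (nm i k)  = refl
  suppT-ren ρ zeroT     = refl
  suppT-ren ρ (succT t) = suppT-ren ρ t
  suppT-ren ρ (lam t)   = suppT-ren (ext ρ) t
  suppT-ren ρ (app t u) = cong₂ _++_ (suppT-ren ρ t) (suppT-ren ρ u)

  suppArgs-renArgs : ∀ {Γ Δ tys} (ρ : Ren Γ Δ) (ts : All (Tm Γ) tys) →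
    suppArgs (renArgs ρ ts) ≡ suppArgs ts
  suppArgs-renArgs ρ []       = refl
  suppArgs-renArgs ρ (t ∷ ts) = cong₂ _++_ (suppT-ren ρ t) (suppArgs-renArgs ρ ts)

  suppF-renF : ∀ {Γ Δ} (ρ : Ren Γ Δ) (A : Fm Γ) → suppF (renF ρ A) ≡ suppF A
  suppF-renF ρ ⊤F          = refl
  suppF-renF ρ ⊥F          = refl
  suppF-renF ρ (A ∧F B)    = cong₂ _++_ (suppF-renF ρ A) (suppF-renF ρ B)
  suppF-renF ρ (A ∨F B)    = cong₂ _++_ (suppF-renF ρ A) (suppF-renF ρ B)
  suppF-renF ρ (A ⊃F B)    = cong₂ _++_ (suppF-renF ρ A) (suppF-renF ρ B)
  suppF-renF ρ (∀F τ B)    = suppF-renF (ext ρ) B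
  suppF-renF ρ (∃F τ B)    = suppF-renF (ext ρ) B
  suppF-renF ρ (∇F i B)    = suppF-renF (ext ρ) B
  suppF-renF ρ (eqF τ s t) = cong₂ _++_ (suppT-ren ρ s) (suppT-ren ρ t)
  suppF-renF ρ (natF t)    = suppT-ren ρ t
  suppF-renF ρ (defF p ts) = suppArgs-renArgs ρ ts

  permT-ren : ∀ {Γ Δ τ} (π : Perm) (ρ : Ren Γ Δ) (t : Tm Γ τ) →
    permT π (ren ρ t) ≡ ren ρ (permT π t)
  permT-ren π ρ (var x)   = refl
  permT-ren π ρ (con c)   = refl
  permT-ren π ρ (nm i k)  = refl
  permT-ren π ρ zeroT     = refl
  permT-ren π ρ (succT t) = cong succT (permT-ren π ρ t)
  permT-ren π ρ (lam t)   = cong lam (permT-ren π (ext ρ) t)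
  permT-ren π ρ (app t u) = cong₂ app (permT-ren π ρ t) (permT-ren π ρ u)

  permArgs-renArgs : ∀ {Γ Δ tys} (π : Perm) (ρ : Ren Γ Δ) (ts : All (Tm Γ) tys) →
    permArgs π (renArgs ρ ts) ≡ renArgs ρ (permArgs π ts)
  permArgs-renArgs π ρ []       = refl
  permArgs-renArgs π ρ (t ∷ ts) = cong₂ _∷_ (permT-ren π ρ t) (permArgs-renArgs π ρ ts)

  permF-renF : ∀ {Γ Δ} (π : Perm) (ρ : Ren Γ Δ) (A : Fm Γ) →
    permF π (renF ρ A) ≡ renF ρ (permF π A)
  permF-renF π ρ ⊤F          = refl
  permF-renF π ρ ⊥F          = refl
  permF-renF π ρ (A ∧F B)    = cong₂ _∧F_ (permF-renF π ρ A) (permF-renF π ρ B)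
  permF-renF π ρ (A ∨F B)    = cong₂ _∨F_ (permF-renF π ρ A) (permF-renF π ρ B)
  permF-renF π ρ (A ⊃F B)    = cong₂ _⊃F_ (permF-renF π ρ A) (permF-renF π ρ B)
  permF-renF π ρ (∀F τ B)    = cong (∀F τ) (permF-renF π (ext ρ) B)
  permF-renF π ρ (∃F τ B)    = cong (∃F τ) (permF-renF π (ext ρ) B)
  permF-renF π ρ (∇F i B)    = cong (∇F i) (permF-renF π (ext ρ) B)
  permF-renF π ρ (eqF τ s t) = cong₂ (eqF τ) (permT-ren π ρ s) (permT-ren π ρ t)
  permF-renF π ρ (natF t)    = cong natF (permT-ren π ρ t)
  permF-renF π ρ (defF p ts) = cong (defF p) (permArgs-renArgs π ρ ts)

  ≈-ren : ∀ {Γ Δ τ} (ρ : Ren Γ Δ) {t u : Tm Γ τ} → t ≈ u → ren ρ t ≈ ren ρ u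
  ≈-ren ρ (β t u)      = subst (app (lam (ren (ext ρ) t)) (ren ρ u) ≈_)
                           (sym (ren-sub0 ρ u t)) (β (ren (ext ρ) t) (ren ρ u))
  ≈-ren ρ (η t)        = subst (λ t' → lam (app t' (var here)) ≈ ren ρ t)
                           (sym (ren-ext-wk ρ t)) (η (ren ρ t))
  ≈-ren ρ ≈refl        = ≈refl
  ≈-ren ρ (≈sym p)     = ≈sym (≈-ren ρ p)
  ≈-ren ρ (≈trans p q) = ≈trans (≈-ren ρ p) (≈-ren ρ q)
  ≈-ren ρ (succ≈ p)    = succ≈ (≈-ren ρ p)
  ≈-ren ρ (lam≈ p)     = lam≈ (≈-ren (ext ρ) p)
  ≈-ren ρ (app≈ p q)   = app≈ (≈-ren ρ p) (≈-ren ρ q)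

  ≈A-renArgs : ∀ {Γ Δ tys} (ρ : Ren Γ Δ) {ts us : All (Tm Γ) tys} →
    ts ≈A us → renArgs ρ ts ≈A renArgs ρ us
  ≈A-renArgs ρ []       = []
  ≈A-renArgs ρ (p ∷ ps) = ≈-ren ρ p ∷ ≈A-renArgs ρ ps

  ≈F-renF : ∀ {Γ Δ} (ρ : Ren Γ Δ) {A B : Fm Γ} → A ≈F B → renF ρ A ≈F renF ρ B
  ≈F-renF ρ ⊤≈        = ⊤≈
  ≈F-renF ρ ⊥≈        = ⊥≈
  ≈F-renF ρ (∧≈ p q)  = ∧≈ (≈F-renF ρ p) (≈F-renF ρ q)
  ≈F-renF ρ (∨≈ p q)  = ∨≈ (≈F-renF ρ p) (≈F-renF ρ q)
  ≈F-renF ρ (⊃≈ p q)  = ⊃≈ (≈F-renF ρ p) (≈F-renF ρ q)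
  ≈F-renF ρ (∀≈ p)    = ∀≈ (≈F-renF (ext ρ) p)
  ≈F-renF ρ (∃≈ p)    = ∃≈ (≈F-renF (ext ρ) p)
  ≈F-renF ρ (∇≈ p)    = ∇≈ (≈F-renF (ext ρ) p)
  ≈F-renF ρ (eq≈ p q) = eq≈ (≈-ren ρ p) (≈-ren ρ q)
  ≈F-renF ρ (nat≈ p)  = nat≈ (≈-ren ρ p)
  ≈F-renF ρ (def≈ p)  = def≈ (≈A-renArgs ρ p)

  ≈A-refl : ∀ {Γ tys} (ts : All (Tm Γ) tys) → ts ≈A ts
  ≈A-refl []       = []
  ≈A-refl (t ∷ ts) = ≈refl ∷ ≈A-refl ts

  ≈F-refl : ∀ {Γ} (A : Fm Γ) → A ≈F A
  ≈F-refl ⊤F          = ⊤≈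
  ≈F-refl ⊥F          = ⊥≈
  ≈F-refl (A ∧F B)    = ∧≈ (≈F-refl A) (≈F-refl B)
  ≈F-refl (A ∨F B)    = ∨≈ (≈F-refl A) (≈F-refl B)
  ≈F-refl (A ⊃F B)    = ⊃≈ (≈F-refl A) (≈F-refl B)
  ≈F-refl (∀F τ B)    = ∀≈ (≈F-refl B)
  ≈F-refl (∃F τ B)    = ∃≈ (≈F-refl B)
  ≈F-refl (∇F i B)    = ∇≈ (≈F-refl B)
  ≈F-refl (eqF τ s t) = eq≈ ≈refl ≈refl
  ≈F-refl (natF t)    = nat≈ ≈refl
  ≈F-refl (defF p ts) = def≈ (≈A-refl ts)

  ren-absNomG : ∀ {Γ Δ Θ τ} (i k : ℕ) {σ : Ren Γ Δ} {ρ : Ren Δ Θ} {σ'' : Ren Γ Θ}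
    (v : Δ ∋ nom i) → (∀ {τ} (x : Γ ∋ τ) → ρ (σ x) ≡ σ'' x) → (t : Tm Γ τ) →
    ren ρ (absNomG i k σ v t) ≡ absNomG i k σ'' (ρ v) t
  ren-absNomG i k v h (var x)   = cong var (h x)
  ren-absNomG i k v h (con c)   = refl
  ren-absNomG i k v h (nm i' k') with i ≟ i' | k ≟ k'
  ... | yes refl | yes refl = refl
  ... | yes refl | no _     = refl
  ... | no _     | _        = refl
  ren-absNomG i k v h zeroT     = refl
  ren-absNomG i k v h (succT t) = cong succT (ren-absNomG i k v h t)
  ren-absNomG i k v h (lam t)   = cong lam (ren-absNomG i k (there v) (ext-ren h) t)
  ren-absNomG i k v h (app t u) = cong₂ app (ren-absNomG i k v h t) (ren-absNomG i k v h u)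

  absNomG-ren : ∀ {Γ Δ Θ τ} (i k : ℕ) {ρ : Ren Γ Δ} {σ : Ren Δ Θ} {σ'' : Ren Γ Θ}
    (v : Θ ∋ nom i) → (∀ {τ} (x : Γ ∋ τ) → σ (ρ x) ≡ σ'' x) → (t : Tm Γ τ) →
    absNomG i k σ v (ren ρ t) ≡ absNomG i k σ'' v t
  absNomG-ren i k v h (var x)   = cong var (h x)
  absNomG-ren i k v h (con c)   = refl
  absNomG-ren i k v h (nm i' k') = refl
  absNomG-ren i k v h zeroT     = refl
  absNomG-ren i k v h (succT t) = cong succT (absNomG-ren i k v h t)
  absNomG-ren i k v h (lam t)   = cong lam (absNomG-ren i k (there v) (ext-ren h) t)
  absNomG-ren i k v h (app t u) = cong₂ app (absNomG-ren i k v h t) (absNomG-ren i k v h u)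

  ren-absList : ∀ {Γ Δ τ} (ρ : Ren Γ Δ) (cs : List NomC) (t : Tm Γ τ) →
    ren ρ (absList cs t) ≡ absList cs (ren ρ t)
  ren-absList ρ []             t = refl
  ren-absList ρ ((i , k) ∷ cs) t = cong lam (begin
    ren (ext ρ) (absNomG i k there here (absList cs t))
      ≡⟨ ren-absNomG i k here (λ _ → refl) (absList cs t) ⟩
    absNomG i k (λ x → there (ρ x)) here (absList cs t)
      ≡⟨ absNomG-ren i k here (λ _ → refl) (absList cs t) ⟨
    absNomG i k there here (ren ρ (absList cs t))
      ≡⟨ cong (absNomG i k there here) (ren-absList ρ cs t) ⟩
    absNomG i k there here (absList cs (ren ρ t)) ∎)
    where open ≡-Reasoning

  ren-applyNoms : ∀ {Γ Δ τ} (ρ : Ren Γ Δ) (cs : List NomC) (t : Tm Γ (raise cs τ)) →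
    ren ρ (applyNoms cs t) ≡ applyNoms cs (ren ρ t)
  ren-applyNoms ρ []             t = refl
  ren-applyNoms ρ ((i , k) ∷ cs) t = ren-applyNoms ρ cs (app t (nm i k))

  renF-raiseSub : ∀ {Γ Δ τ} (ρ : Ren Γ Δ) (cs : List NomC) (A : Fm (τ ∷ Γ)) →
    renF (ext ρ) (subF (raiseSub cs) A) ≡ subF (raiseSub cs) (renF (ext ρ) A)
  renF-raiseSub ρ cs A = trans (renF-subF commute A) (sym (subF-renF (λ _ → refl) A))
    where
    commute : ∀ {σ} (x : _ ∋ σ) → ren (ext ρ) (raiseSub cs x) ≡ raiseSub cs (ext ρ x)
    commute here      = ren-applyNoms (ext ρ) cs (var here)
    commute (there x) = refl

  sub0-applyNoms-wk : ∀ {Γ τ} (cs : List NomC) (A : Fm (τ ∷ Γ)) →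
    subF (sub0 (applyNoms cs (var here))) (renF (ext (there {σ = raise cs τ})) A)
      ≡ subF (raiseSub cs) A
  sub0-applyNoms-wk cs A = subF-renF pointwise A
    where
    pointwise : ∀ {σ} (x : _ ∋ σ) →
      sub0 (applyNoms cs (var here)) (ext there x) ≡ raiseSub cs x
    pointwise here      = refl
    pointwise (there x) = refl

module SequentProperties (S : Sig) where
  open LG S
  open SyntaxProperties Con Pred

  cast : ∀ {Ξ Γ Γ' C C'} → Γ ≡ Γ' → C ≡ C' → Ξ ⨾ Γ ⊢ C → Ξ ⨾ Γ' ⊢ C'
  cast refl refl d = d

  map-renF-wkF : ∀ {Ξ Ξ' σ} (ρ : Ren Ξ Ξ') (Γ : List (Fm Ξ)) →
    map (renF (ext {σ = σ} ρ)) (map wkF Γ) ≡ map wkF (map (renF ρ) Γ)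
  map-renF-wkF ρ Γ = trans (sym (map-∘ Γ)) (trans (map-cong (renF-ext-wkF ρ) Γ) (map-∘ Γ))

  map-subF-renF : ∀ {Ξ Ξ' Ξ''} (ρ : Ren Ξ Ξ') (θ : Sub Ξ' Ξ'') (Γ : List (Fm Ξ)) →
    map (subF (λ x → θ (ρ x))) Γ ≡ map (subF θ) (map (renF ρ) Γ)
  map-subF-renF ρ θ Γ =
    trans (map-cong (λ A → sym (subF-renF (λ _ → refl) A)) Γ) (map-∘ Γ)

  renF-unfold : ∀ {Ξ Ξ' tys} (ρ : Ren Ξ Ξ') (p : Pred tys) (ts : All (Tm Ξ) tys) →
    renF ρ (unfold p ts) ≡ unfold p (renArgs ρ ts)
  renF-unfold ρ p ts = renF-subF (argSub-ren ts) (body p)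
    where
    argSub-ren : ∀ {tys} (ts : All (Tm _) tys) →
      ∀ {τ} (x : tys ∋ τ) → ren ρ (argSub ts x) ≡ argSub (renArgs ρ ts) x
    argSub-ren (t ∷ ts) here      = refl
    argSub-ren (t ∷ ts) (there x) = argSub-ren ts x

  renF-single : ∀ {Ξ Ξ' σ} (ρ : Ren Ξ Ξ') (I : Tm Ξ σ) (D : Fm (σ ∷ [])) →
    renF ρ (subF (single I) D) ≡ subF (single (ren ρ I)) D
  renF-single ρ I D = renF-subF (λ { here → refl }) D

  Premise : Ctx → Set
  Premise Ξ = List (Fm Ξ) × Fm Ξ

  renPremise : ∀ {Ξ Ξ'} → Ren Ξ Ξ' → Premise Ξ → Premise Ξ'
  renPremise ρ (Δ , B) = map (renF ρ) Δ , renF ρ B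

  map-renF-cutFormulas : ∀ {Ξ Ξ'} (ρ : Ren Ξ Ξ') (ps : List (Premise Ξ)) (Γ : List (Fm Ξ)) →
    map (renF ρ) (map proj₂ ps ++ Γ) ≡ map proj₂ (map (renPremise ρ) ps) ++ map (renF ρ) Γ
  map-renF-cutFormulas ρ ps Γ =
    trans (map-++ (renF ρ) (map proj₂ ps) Γ) (cong (_++ _) (trans (sym (map-∘ ps)) (map-∘ ps)))

  map-renF-cutContexts : ∀ {Ξ Ξ'} (ρ : Ren Ξ Ξ') (ps : List (Premise Ξ)) (Γ : List (Fm Ξ)) →
    map (renF ρ) (concat (map proj₁ ps) ++ Γ)
      ≡ concat (map proj₁ (map (renPremise ρ) ps)) ++ map (renF ρ) Γ
  map-renF-cutContexts ρ ps Γ = begin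
    map (renF ρ) (concat (map proj₁ ps) ++ Γ)
      ≡⟨ map-++ (renF ρ) (concat (map proj₁ ps)) Γ ⟩
    map (renF ρ) (concat (map proj₁ ps)) ++ map (renF ρ) Γ
      ≡⟨ cong (_++ _) (concat-map (map proj₁ ps)) ⟨
    concat (map (map (renF ρ)) (map proj₁ ps)) ++ map (renF ρ) Γ
      ≡⟨ cong (λ Δs → concat Δs ++ _) (trans (sym (map-∘ ps)) (map-∘ ps)) ⟩
    concat (map proj₁ (map (renPremise ρ) ps)) ++ map (renF ρ) Γ ∎
    where open ≡-Reasoning

  mutual
    ⊢-ren : ∀ {Ξ Ξ' Γ C} (ρ : Ren Ξ Ξ') → Ξ ⨾ Γ ⊢ C → Ξ' ⨾ map (renF ρ) Γ ⊢ renF ρ C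
    ⊢-ren ρ (exch p d) = exch (↭.map⁺ (renF ρ) p) (⊢-ren ρ d)
    ⊢-ren ρ (idπ {B = B} {B' = B'} π π' e) =
      idπ π π' (subst₂ _≈F_ (sym (permF-renF π ρ B)) (sym (permF-renF π' ρ B')) (≈F-renF ρ e))
    ⊢-ren ρ (mc {Γ = Γ} ps ds d) =
      cast (sym (map-renF-cutContexts ρ ps Γ)) refl
        (mc (map (renPremise ρ) ps) (⊢-renPremises ρ ps ds)
          (cast (map-renF-cutFormulas ρ ps Γ) refl (⊢-ren ρ d)))
    ⊢-ren ρ (contr d) = contr (⊢-ren ρ d)
    ⊢-ren ρ ⊥L        = ⊥L
    ⊢-ren ρ ⊤R        = ⊤R
    ⊢-ren ρ (∧L₁ d)   = ∧L₁ (⊢-ren ρ d)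
    ⊢-ren ρ (∧L₂ d)   = ∧L₂ (⊢-ren ρ d)
    ⊢-ren ρ (∧R d e)  = ∧R (⊢-ren ρ d) (⊢-ren ρ e)
    ⊢-ren ρ (∨L d e)  = ∨L (⊢-ren ρ d) (⊢-ren ρ e)
    ⊢-ren ρ (∨R₁ d)   = ∨R₁ (⊢-ren ρ d)
    ⊢-ren ρ (∨R₂ d)   = ∨R₂ (⊢-ren ρ d)
    ⊢-ren ρ (⊃L d e)  = ⊃L (⊢-ren ρ d) (⊢-ren ρ e)
    ⊢-ren ρ (⊃R d)    = ⊃R (⊢-ren ρ d)
    ⊢-ren ρ (∀L {B = B} t d) =
      ∀L (ren ρ t) (cast (cong (_∷ _) (renF-sub0 ρ t B)) refl (⊢-ren ρ d))
    ⊢-ren ρ (∃R {B = B} t d) =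
      ∃R (ren ρ t) (cast refl (renF-sub0 ρ t B) (⊢-ren ρ d))
    ⊢-ren ρ (∀R {Γ = Γ} {B = B} cs l d) =
      ∀R cs (subst (Lists cs) (sym (suppF-renF (ext ρ) B)) l)
        (cast (map-renF-wkF ρ Γ) (renF-raiseSub ρ cs B) (⊢-ren (ext ρ) d))
    ⊢-ren ρ (∃L {Γ = Γ} {B = B} {C = C} cs l d) =
      ∃L cs (subst (Lists cs) (sym (suppF-renF (ext ρ) B)) l)
        (cast (cong₂ _∷_ (renF-raiseSub ρ cs B) (map-renF-wkF ρ Γ)) (renF-ext-wkF ρ C)
          (⊢-ren (ext ρ) d))
    ⊢-ren ρ (∇L {B = B} k fresh d) =
      ∇L k (subst (_ ∉_) (sym (suppF-renF (ext ρ) B)) fresh)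
        (cast (cong (_∷ _) (renF-sub0 ρ (nm _ k) B)) refl (⊢-ren ρ d))
    ⊢-ren ρ (∇R {B = B} k fresh d) =
      ∇R k (subst (_ ∉_) (sym (suppF-renF (ext ρ) B)) fresh)
        (cast refl (renF-sub0 ρ (nm _ k) B) (⊢-ren ρ d))
    ⊢-ren ρ (eqR e) = eqR (≈-ren ρ e)
    ⊢-ren ρ (eqL {Γ = Γ} {τ = τ} {C = C} {s = s} {t = t} cs l f) =
      eqL cs (subst (Lists cs) (sym (suppF-renF ρ (eqF τ s t))) l)
        λ Ξ'' θ nomFree unifies →
          cast (map-subF-renF ρ θ Γ) (sym (subF-renF (λ _ → refl) C))
            (f Ξ'' (λ x → θ (ρ x)) (λ x → nomFree (ρ x))
              (subst₂ _≈_ (sub-absList-ren s) (sub-absList-ren t) unifies))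
      where
      sub-absList-ren : ∀ {Ξ''} {θ : Sub _ Ξ''} (u : Tm _ τ) →
        sub θ (absList cs (ren ρ u)) ≡ sub (λ x → θ (ρ x)) (absList cs u)
      sub-absList-ren {θ = θ} u =
        trans (cong (sub θ) (sym (ren-absList ρ cs u))) (sub-ren (λ _ → refl) (absList cs u))
    ⊢-ren ρ (defL p ts d) =
      defL p (renArgs ρ ts) (cast (cong (_∷ _) (renF-unfold ρ p ts)) refl (⊢-ren ρ d))
    ⊢-ren ρ (defR p ts d) =
      defR p (renArgs ρ ts) (cast refl (renF-unfold ρ p ts) (⊢-ren ρ d))
    ⊢-ren ρ natRz     = natRz
    ⊢-ren ρ (natRs d) = natRs (⊢-ren ρ d)
    ⊢-ren ρ (natL {I = I} D base step d) =
      natL D base step (cast (cong (_∷ _) (renF-single ρ I D)) refl (⊢-ren ρ d))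

    ⊢-renPremises : ∀ {Ξ Ξ'} (ρ : Ren Ξ Ξ') (ps : List (Premise Ξ)) →
      All (λ p → Ξ ⨾ proj₁ p ⊢ proj₂ p) ps →
      All (λ p → Ξ' ⨾ proj₁ p ⊢ proj₂ p) (map (renPremise ρ) ps)
    ⊢-renPremises ρ []             []       = []
    ⊢-renPremises ρ ((Δ , B) ∷ ps) (d ∷ ds) = ⊢-ren ρ d ∷ ⊢-renPremises ρ ps ds

  ⊢-∀-instance : ∀ {Ξ Γ τ B} → Ξ ⨾ Γ ⊢ ∀F τ B → (t : Tm Ξ τ) → Ξ ⨾ Γ ⊢ subF (sub0 t) B
  ⊢-∀-instance {Γ = Γ} {τ} {B} d t =
    cast (trans (++-identityʳ _) (++-identityʳ Γ)) refl
      (mc ((Γ , ∀F τ B) ∷ []) (d ∷ [])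
        (∀L t (idπ [] [] (≈F-refl (permF [] (subF (sub0 t) B))))))

lemma8 : (S : Sig) → let open LG S in
    ∀ {Ξ : Ctx} {τ : Ty} (B : Fm (τ ∷ Ξ)) (Γ : List (Fm Ξ)) (as cs : List NomC) →
    Lists as (suppF B) →
    (∀ c → c ∈ cs → c ∉ suppF B) →
    (raise as τ ∷ Ξ) ⨾ map wkF Γ ⊢ subF (raiseSub as) B →
    (raise (as ++ cs) τ ∷ Ξ) ⨾ map wkF Γ ⊢ subF (raiseSub (as ++ cs)) B
lemma8 S {τ = τ} B Γ as cs as-lists-suppB _ ⊢B[h⃗as] =
  cast refl (sub0-applyNoms-wk (as ++ cs) B)
    (⊢-∀-instance (⊢-ren there ⊢∀B) (applyNoms (as ++ cs) (var here)))
  where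
  open LG S
  open SyntaxProperties Con Pred
  open SequentProperties S
  ⊢∀B : _ ⨾ Γ ⊢ ∀F τ B
  ⊢∀B = ∀R as as-lists-suppB ⊢B[h⃗as]
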